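{- For every positive integer $n$, writing the $n$-th $P$-sequence as $P_n=\langle a_0,\dots,a_k\rangle$ and setting $F_{n,s}(x)=\sum_{i=0}^k a_i(i+x)^s$, for every integer $s\ge n$ the polynomial $F_{n,s}$ has degree exactly $s-n$ (in particular $F_{n,n}$ is a nonzero constant).
   Context: Convention: $0^0=1$. $P$-sequences are finite sequences of integers defined recursively: $\langle 1,-1\rangle$ is a $P$-sequence; if $\langle a_0,\dots,a_k\rangle$ is a $P$-sequence with $a_0=-a_k$, then $\langle a_0,\dots,a_k,a_k,\dots,a_0\rangle$ (the sequence followed by its reversal) is a $P$-sequence; if $\langle a_0,\dots,a_k\rangle$ is a $P$-sequence with $a_0=a_k$, then $\langle a_0,\dots,a_{k-1},0,-a_{k-1},\dots,-a_0\rangle$ is a $P$-sequence; and every $P$-sequence arises by finitely many applications of these clauses. Ordering $P$-sequences by increasing length, $P_n$ denotes the $n$-th one; e.g. $P_1=\langle 1,-1\rangle$, $P_2=\langle 1,-1,-1,1\rangle$, $P_3=\langle 1,-1,-1,0,1,1,-1\rangle$. For $P_n=\langle a_0,\dots,a_k\rangle$ and integer $s\ge 0$, $F_{n,s}(x)=\sum_{i=0}^k a_i(i+x)^s$. -}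

module Defs where

open import Data.Nat as ℕ using (ℕ; zero; suc; _∸_; _<_)
open import Data.Integer as ℤ using (ℤ; +_; -_; _+_; _*_; 0ℤ; 1ℤ; -1ℤ)
open import Data.List using (List; []; _∷_; _++_; reverse; map)
open import Relation.Nullary using (yes; no; ¬_)
open import Relation.Binary.PropositionalEquality using (_≡_)
open import Function using (_∘_)

lastOr : ℤ → List ℤ → ℤ
lastOr d []       = d
lastOr d (x ∷ xs) = lastOr x xs

dropLast : List ℤ → List ℤ
dropLast []           = []
dropLast (x ∷ [])     = []
dropLast (x ∷ y ∷ xs) = x ∷ dropLast (y ∷ xs)

-- One application of the generating clauses to ⟨a₀,…,a_k⟩.
--  * if a₀ = -a_k : ⟨a₀,…,a_k,a_k,…,a₀⟩
--  * if a₀ =  a_k : ⟨a₀,…,a_{k-1},0,-a_{k-1},…,-a₀⟩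
-- (a₀ = 1 always, so the two clauses never both apply; the final
--  fallback case never occurs for actual P-sequences.)
step : List ℤ → List ℤ
step []       = []
step (a ∷ as) with a ℤ.≟ (- lastOr a as)
... | yes _ = (a ∷ as) ++ reverse (a ∷ as)
... | no _ with a ℤ.≟ lastOr a as
...   | yes _ = dropLast (a ∷ as) ++ (0ℤ ∷ map -_ (reverse (dropLast (a ∷ as))))
...   | no _  = a ∷ as

P₁ : List ℤ
P₁ = 1ℤ ∷ -1ℤ ∷ []

iter : ℕ → List ℤ → List ℤ
iter zero    xs = xs
iter (suc m) xs = step (iter m xs)

-- P n = P_n (the n-th P-sequence, n ≥ 1); P 0 is junk (= P₁).
P : ℕ → List ℤ
P n = iter (n ∸ 1) P₁

-- Integer polynomials as coefficient lists (constant term first)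

Poly : Set
Poly = List ℤ

_+ₚ_ : Poly → Poly → Poly
[]       +ₚ q        = q
(a ∷ p)  +ₚ []       = a ∷ p
(a ∷ p)  +ₚ (b ∷ q)  = (a + b) ∷ (p +ₚ q)

scale : ℤ → Poly → Poly
scale c = map (c *_)

_*ₚ_ : Poly → Poly → Poly
[]      *ₚ q = []
(a ∷ p) *ₚ q = scale a q +ₚ (0ℤ ∷ (p *ₚ q))

_^ₚ_ : Poly → ℕ → Poly
p ^ₚ zero  = 1ℤ ∷ []
p ^ₚ suc s = p *ₚ (p ^ₚ s)

linear : ℕ → Poly
linear i = (+ i) ∷ 1ℤ ∷ []

coeff : Poly → ℕ → ℤ
coeff []      j       = 0ℤ
coeff (a ∷ p) zero    = a
coeff (a ∷ p) (suc j) = coeff p j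

HasDegree : Poly → ℕ → Set
HasDegree p d = (¬ coeff p d ≡ 0ℤ) × (∀ j → d < j → coeff p j ≡ 0ℤ)
  where open import Data.Product using (_×_)

Fsum : ℕ → ℕ → List ℤ → Poly
Fsum s i₀ []       = []
Fsum s i₀ (a ∷ as) = scale a (linear i₀ ^ₚ s) +ₚ Fsum s (suc i₀) as

F : ℕ → ℕ → Poly
F n s = Fsum s 0 (P n)

-- Expanding (i + x)^s, the coefficient of x^k in F_{n,s} is C(s,k) · μ_{s-k}(0), where
-- μ_j(y) = Σ aᵢ (y + i)^j is the j-th moment of P_n. So it suffices that μ_j vanishes
-- identically for j < n while μ_n(0) ≠ 0; we carry along also the antisymmetry
-- μ_{n+1}(x) = -μ_{n+1}(1 - L - x), L the length of P_n. Both generating clauses turn A into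
-- a B with μᴮ_j(x) = μᴬ_j(x) ∓ (-1)^j μᴬ_j(1 - L_B - x). Vanishing of the lower moments makes
-- μᴬ_n constant and μᴬ_{n+1} affine with slope (n+1) μᴬ_n(0); hence μᴮ_j = 0 for j ≤ n, and the
-- antisymmetry gives μᴮ_{n+1}(0) = (n+1) μᴬ_n(0) (L_A - L_B) ≠ 0.

module Submission where

open import Defs
open import Data.Nat as ℕ using (ℕ; zero; suc; _∸_; _≤_; _<_; z≤n; s≤s)
import Data.Nat.Properties as ℕₚ
open import Data.Nat.Combinatorics using (_C_; nC1≡n; k>n⇒nCk≡0; nCk+nC[k+1]≡[n+1]C[k+1])
open import Data.Integer as ℤ using (ℤ; +_; -_; _+_; _*_; _-_; 0ℤ; 1ℤ; -1ℤ; _^_)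
import Data.Integer.Properties as ℤₚ
open import Data.Integer.Tactic.RingSolver using (solve-∀)
open import Data.List using (List; []; _∷_; _++_; reverse; map; length)
import Data.List.Properties as Listₚ
open import Data.Product using (_,_)
open import Data.Sum using (_⊎_; inj₁; inj₂)
open import Relation.Nullary using (yes; no; contradiction)
open import Relation.Binary.PropositionalEquality
open import Function using (_∘_)

nCk≢0 : ∀ {n k} → k ≤ n → n C k ≢ 0
nCk≢0 {k = zero}  _          ()
nCk≢0 {suc n} {suc k} (s≤s k≤n) eq =
  nCk≢0 k≤n (ℕₚ.m+n≡0⇒m≡0 _ (trans (nCk+nC[k+1]≡[n+1]C[k+1] n k) eq))

*-≢0 : ∀ {i j} → i ≢ 0ℤ → j ≢ 0ℤ → i * j ≢ 0ℤ
*-≢0 {i} i≢0 j≢0 ij≡0 with ℤₚ.i*j≡0⇒i≡0∨j≡0 i ij≡0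
... | inj₁ i≡0 = i≢0 i≡0
... | inj₂ j≡0 = j≢0 j≡0

-1^n≡1⊎-1^n≡-1 : ∀ n → -1ℤ ^ n ≡ 1ℤ ⊎ -1ℤ ^ n ≡ -1ℤ
-1^n≡1⊎-1^n≡-1 zero = inj₁ refl
-1^n≡1⊎-1^n≡-1 (suc n) with -1^n≡1⊎-1^n≡-1 n
... | inj₁ eq = inj₂ (cong (-1ℤ *_) eq)
... | inj₂ eq = inj₁ (cong (-1ℤ *_) eq)

-1^n*-1^n≡1 : ∀ n → -1ℤ ^ n * -1ℤ ^ n ≡ 1ℤ
-1^n*-1^n≡1 zero    = refl
-1^n*-1^n≡1 (suc n) = trans (regroup (-1ℤ ^ n)) (-1^n*-1^n≡1 n)
  where
  regroup : ∀ a → -1ℤ * a * (-1ℤ * a) ≡ a * a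
  regroup = solve-∀

-1^s*[-z]^s≡z^s : ∀ s z → -1ℤ ^ s * (- z) ^ s ≡ z ^ s
-1^s*[-z]^s≡z^s zero    z = refl
-1^s*[-z]^s≡z^s (suc s) z = trans (regroup (-1ℤ ^ s) ((- z) ^ s) z) (cong (z *_) (-1^s*[-z]^s≡z^s s z))
  where
  regroup : ∀ a b z → -1ℤ * a * (- z * b) ≡ z * (a * b)
  regroup = solve-∀

-- Coefficients and values of polynomials

coeff-+ₚ : ∀ p q m → coeff (p +ₚ q) m ≡ coeff p m + coeff q m
coeff-+ₚ []      q       m       = sym (ℤₚ.+-identityˡ _)
coeff-+ₚ (a ∷ p) []      m       = sym (ℤₚ.+-identityʳ _)
coeff-+ₚ (a ∷ p) (b ∷ q) zero    = refl
coeff-+ₚ (a ∷ p) (b ∷ q) (suc m) = coeff-+ₚ p q m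

coeff-scale : ∀ c p m → coeff (scale c p) m ≡ c * coeff p m
coeff-scale c []      m       = sym (ℤₚ.*-zeroʳ c)
coeff-scale c (a ∷ p) zero    = refl
coeff-scale c (a ∷ p) (suc m) = coeff-scale c p m

coeff-∷-*ₚ-zero : ∀ a p q → coeff ((a ∷ p) *ₚ q) 0 ≡ a * coeff q 0
coeff-∷-*ₚ-zero a p q =
  trans (coeff-+ₚ (scale a q) _ 0) (trans (ℤₚ.+-identityʳ _) (coeff-scale a q 0))

coeff-∷-*ₚ-suc : ∀ a p q m → coeff ((a ∷ p) *ₚ q) (suc m) ≡ a * coeff q (suc m) + coeff (p *ₚ q) m
coeff-∷-*ₚ-suc a p q m =
  trans (coeff-+ₚ (scale a q) _ (suc m)) (cong (_+ coeff (p *ₚ q) m) (coeff-scale a q (suc m)))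

coeff-constant-*ₚ : ∀ a q m → coeff ((a ∷ []) *ₚ q) m ≡ a * coeff q m
coeff-constant-*ₚ a q zero    = coeff-∷-*ₚ-zero a [] q
coeff-constant-*ₚ a q (suc m) = trans (coeff-∷-*ₚ-suc a [] q m) (ℤₚ.+-identityʳ _)

-- For m ≥ s the exponent identity fails (∸ truncates), but then s C suc m = 0.
C-suc-^ : ∀ s m z → + (s C suc m) * z ^ (s ∸ m) ≡ z * (+ (s C suc m) * z ^ (s ∸ suc m))
C-suc-^ s m z with m ℕ.<? s
... | yes m<s = trans (cong (λ e → + (s C suc m) * z ^ e) (ℕₚ.+-∸-assoc 1 m<s))
                      (regroup (+ (s C suc m)) z (z ^ (s ∸ suc m)))
  where
  regroup : ∀ c z w → c * (z * w) ≡ z * (c * w)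
  regroup = solve-∀
... | no m≮s rewrite k>n⇒nCk≡0 (s≤s (ℕₚ.≮⇒≥ m≮s)) = sym (ℤₚ.*-zeroʳ z)

coeff-linear-^ₚ : ∀ i s m → coeff (linear i ^ₚ s) m ≡ + (s C m) * (+ i) ^ (s ∸ m)
coeff-linear-^ₚ i zero    zero    = refl
coeff-linear-^ₚ i zero    (suc m) = refl
coeff-linear-^ₚ i (suc s) zero    =
  trans (coeff-∷-*ₚ-zero (+ i) (1ℤ ∷ []) (linear i ^ₚ s))
        (trans (cong (+ i *_) (coeff-linear-^ₚ i s 0)) (regroup (+ i) ((+ i) ^ s)))
  where
  regroup : ∀ z w → z * (+ 1 * w) ≡ + 1 * (z * w)
  regroup = solve-∀
coeff-linear-^ₚ i (suc s) (suc m) = begin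
  coeff (linear i *ₚ (linear i ^ₚ s)) (suc m)
    ≡⟨ coeff-∷-*ₚ-suc (+ i) (1ℤ ∷ []) (linear i ^ₚ s) m ⟩
  + i * coeff (linear i ^ₚ s) (suc m) + coeff ((1ℤ ∷ []) *ₚ (linear i ^ₚ s)) m
    ≡⟨ cong₂ _+_ (cong (+ i *_) (coeff-linear-^ₚ i s (suc m)))
                 (trans (coeff-constant-*ₚ 1ℤ (linear i ^ₚ s) m)
                        (trans (ℤₚ.*-identityˡ _) (coeff-linear-^ₚ i s m))) ⟩
  + i * (+ (s C suc m) * (+ i) ^ (s ∸ suc m)) + + (s C m) * (+ i) ^ (s ∸ m)
    ≡⟨ cong (_+ + (s C m) * (+ i) ^ (s ∸ m)) (C-suc-^ s m (+ i)) ⟨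
  + (s C suc m) * (+ i) ^ (s ∸ m) + + (s C m) * (+ i) ^ (s ∸ m)
    ≡⟨ ℤₚ.*-distribʳ-+ ((+ i) ^ (s ∸ m)) (+ (s C suc m)) (+ (s C m)) ⟨
  + (s C suc m ℕ.+ s C m) * (+ i) ^ (s ∸ m)
    ≡⟨ cong (λ c → + c * (+ i) ^ (s ∸ m))
            (trans (ℕₚ.+-comm (s C suc m) (s C m)) (nCk+nC[k+1]≡[n+1]C[k+1] s m)) ⟩
  + (suc s C suc m) * (+ i) ^ (s ∸ m) ∎
  where open ≡-Reasoning

eval : Poly → ℤ → ℤ
eval []      y = 0ℤ
eval (a ∷ p) y = a + y * eval p y

eval-+ₚ : ∀ p q y → eval (p +ₚ q) y ≡ eval p y + eval q y
eval-+ₚ []      q       y = sym (ℤₚ.+-identityˡ _)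
eval-+ₚ (a ∷ p) []      y = sym (ℤₚ.+-identityʳ _)
eval-+ₚ (a ∷ p) (b ∷ q) y =
  trans (cong (λ v → a + b + y * v) (eval-+ₚ p q y)) (regroup a b y (eval p y) (eval q y))
  where
  regroup : ∀ a b y u v → a + b + y * (u + v) ≡ (a + y * u) + (b + y * v)
  regroup = solve-∀

eval-scale : ∀ c p y → eval (scale c p) y ≡ c * eval p y
eval-scale c []      y = sym (ℤₚ.*-zeroʳ c)
eval-scale c (a ∷ p) y =
  trans (cong (λ v → c * a + y * v) (eval-scale c p y)) (regroup c a y (eval p y))
  where
  regroup : ∀ c a y u → c * a + y * (c * u) ≡ c * (a + y * u)
  regroup = solve-∀

eval-*ₚ : ∀ p q y → eval (p *ₚ q) y ≡ eval p y * eval q y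
eval-*ₚ []      q y = sym (ℤₚ.*-zeroˡ (eval q y))
eval-*ₚ (a ∷ p) q y = begin
  eval (scale a q +ₚ (0ℤ ∷ (p *ₚ q))) y
    ≡⟨ eval-+ₚ (scale a q) (0ℤ ∷ (p *ₚ q)) y ⟩
  eval (scale a q) y + (0ℤ + y * eval (p *ₚ q) y)
    ≡⟨ cong₂ (λ u v → u + (0ℤ + y * v)) (eval-scale a q y) (eval-*ₚ p q y) ⟩
  a * eval q y + (0ℤ + y * (eval p y * eval q y))
    ≡⟨ regroup a y (eval p y) (eval q y) ⟩
  (a + y * eval p y) * eval q y ∎
  where
  open ≡-Reasoning
  regroup : ∀ a y u v → a * v + (0ℤ + y * (u * v)) ≡ (a + y * u) * v
  regroup = solve-∀

eval-linear-^ₚ : ∀ i s y → eval (linear i ^ₚ s) y ≡ (+ i + y) ^ s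
eval-linear-^ₚ i zero    y = cong (λ v → 1ℤ + v) (ℤₚ.*-zeroʳ y)
eval-linear-^ₚ i (suc s) y =
  trans (eval-*ₚ (linear i) (linear i ^ₚ s) y) (cong₂ _*_ (regroup (+ i) y) (eval-linear-^ₚ i s y))
  where
  regroup : ∀ z y → z + y * (1ℤ + y * 0ℤ) ≡ z + y
  regroup = solve-∀

coeff≡0⇒eval≡0 : ∀ p y → (∀ m → coeff p m ≡ 0ℤ) → eval p y ≡ 0ℤ
coeff≡0⇒eval≡0 []      y p≡0 = refl
coeff≡0⇒eval≡0 (a ∷ p) y p≡0 =
  trans (cong₂ (λ u v → u + y * v) (p≡0 0) (coeff≡0⇒eval≡0 p y (p≡0 ∘ suc)))
        (trans (ℤₚ.+-identityˡ _) (ℤₚ.*-zeroʳ y))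

eval-degree≤1 : ∀ p y → (∀ m → coeff p (suc (suc m)) ≡ 0ℤ) → eval p y ≡ coeff p 0 + coeff p 1 * y
eval-degree≤1 []          y _   = refl
eval-degree≤1 (a ∷ [])    y _   = cong (λ v → a + v) (ℤₚ.*-zeroʳ y)
eval-degree≤1 (a ∷ b ∷ p) y p≡0 =
  trans (cong (λ v → a + y * (b + y * v)) (coeff≡0⇒eval≡0 p y p≡0)) (linear-value a b y)
  where
  linear-value : ∀ a b y → a + y * (b + y * 0ℤ) ≡ a + b * y
  linear-value = solve-∀

-- Moments of a sequence

moment : ℕ → ℤ → List ℤ → ℤ
moment s x []       = 0ℤ
moment s x (a ∷ as) = a * x ^ s + moment s (1ℤ + x) as

coeff-Fsum : ∀ s i A m → coeff (Fsum s i A) m ≡ + (s C m) * moment (s ∸ m) (+ i) A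
coeff-Fsum s i []       m = sym (ℤₚ.*-zeroʳ (+ (s C m)))
coeff-Fsum s i (a ∷ as) m = begin
  coeff (scale a (linear i ^ₚ s) +ₚ Fsum s (suc i) as) m
    ≡⟨ coeff-+ₚ (scale a (linear i ^ₚ s)) (Fsum s (suc i) as) m ⟩
  coeff (scale a (linear i ^ₚ s)) m + coeff (Fsum s (suc i) as) m
    ≡⟨ cong₂ _+_ (trans (coeff-scale a (linear i ^ₚ s) m) (cong (a *_) (coeff-linear-^ₚ i s m)))
                 (coeff-Fsum s (suc i) as m) ⟩
  a * (c * (+ i) ^ (s ∸ m)) + c * moment (s ∸ m) (+ suc i) as
    ≡⟨ regroup c a ((+ i) ^ (s ∸ m)) (moment (s ∸ m) (+ suc i) as) ⟩
  c * (a * (+ i) ^ (s ∸ m) + moment (s ∸ m) (+ suc i) as) ∎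
  where
  open ≡-Reasoning
  c : ℤ
  c = + (s C m)
  regroup : ∀ c a w e → a * (c * w) + c * e ≡ c * (a * w + e)
  regroup = solve-∀

eval-Fsum : ∀ s i A y → eval (Fsum s i A) y ≡ moment s (+ i + y) A
eval-Fsum s i []       y = refl
eval-Fsum s i (a ∷ as) y = begin
  eval (scale a (linear i ^ₚ s) +ₚ Fsum s (suc i) as) y
    ≡⟨ eval-+ₚ (scale a (linear i ^ₚ s)) (Fsum s (suc i) as) y ⟩
  eval (scale a (linear i ^ₚ s)) y + eval (Fsum s (suc i) as) y
    ≡⟨ cong₂ _+_ (trans (eval-scale a (linear i ^ₚ s) y) (cong (a *_) (eval-linear-^ₚ i s y)))
                 (eval-Fsum s (suc i) as y) ⟩
  a * (+ i + y) ^ s + moment s (+ suc i + y) as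
    ≡⟨ cong (λ x → a * (+ i + y) ^ s + moment s x as) (ℤₚ.+-assoc 1ℤ (+ i) y) ⟩
  a * (+ i + y) ^ s + moment s (1ℤ + (+ i + y)) as ∎
  where open ≡-Reasoning

MomentsVanishBelow : ℕ → List ℤ → Set
MomentsVanishBelow n A = ∀ j → j < n → ∀ x → moment j x A ≡ 0ℤ

module _ {n A} (vanish : MomentsVanishBelow n A) where

  coeff-Fsum-vanishes : ∀ s i m → s < m ℕ.+ n → coeff (Fsum s i A) m ≡ 0ℤ
  coeff-Fsum-vanishes s i m s<m+n with m ℕ.≤? s
  ... | yes m≤s = trans (coeff-Fsum s i A m)
                        (trans (cong (+ (s C m) *_) (vanish (s ∸ m) s∸m<n (+ i))) (ℤₚ.*-zeroʳ (+ (s C m))))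
    where
    s∸m<n : s ∸ m < n
    s∸m<n = subst (s ∸ m <_) (ℕₚ.m+n∸m≡n m n) (ℕₚ.∸-monoˡ-< s<m+n m≤s)
  ... | no m≰s = trans (coeff-Fsum s i A m)
                       (cong (λ c → + c * moment (s ∸ m) (+ i) A) (k>n⇒nCk≡0 (ℕₚ.≰⇒> m≰s)))

  moment-constant : ∀ y → moment n y A ≡ moment n 0ℤ A
  moment-constant y = begin
    moment n y A
      ≡⟨ cong (λ x → moment n x A) (ℤₚ.+-identityˡ y) ⟨
    moment n (0ℤ + y) A
      ≡⟨ eval-Fsum n 0 A y ⟨
    eval (Fsum n 0 A) y
      ≡⟨ eval-degree≤1 (Fsum n 0 A) y (λ m → coeff-Fsum-vanishes n 0 (2 ℕ.+ m) (n<2+m+n m)) ⟩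
    coeff (Fsum n 0 A) 0 + coeff (Fsum n 0 A) 1 * y
      ≡⟨ cong₂ (λ u v → u + v * y) (coeff-Fsum n 0 A 0) (coeff-Fsum-vanishes n 0 1 (ℕₚ.n<1+n n)) ⟩
    + 1 * moment n 0ℤ A + 0ℤ * y
      ≡⟨ trans (ℤₚ.+-identityʳ (+ 1 * moment n 0ℤ A)) (ℤₚ.*-identityˡ (moment n 0ℤ A)) ⟩
    moment n 0ℤ A ∎
    where
    open ≡-Reasoning
    n<2+m+n : ∀ m → n < 2 ℕ.+ m ℕ.+ n
    n<2+m+n m = s≤s (ℕₚ.m≤n+m n (suc m))

  moment-affine : ∀ y → moment (suc n) y A ≡ moment (suc n) 0ℤ A + + suc n * moment n 0ℤ A * y
  moment-affine y = begin
    moment (suc n) y A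
      ≡⟨ cong (λ x → moment (suc n) x A) (ℤₚ.+-identityˡ y) ⟨
    moment (suc n) (0ℤ + y) A
      ≡⟨ eval-Fsum (suc n) 0 A y ⟨
    eval (Fsum (suc n) 0 A) y
      ≡⟨ eval-degree≤1 (Fsum (suc n) 0 A) y (λ m → coeff-Fsum-vanishes (suc n) 0 (2 ℕ.+ m) (1+n<2+m+n m)) ⟩
    coeff (Fsum (suc n) 0 A) 0 + coeff (Fsum (suc n) 0 A) 1 * y
      ≡⟨ cong₂ (λ u v → u + v * y) (coeff-Fsum (suc n) 0 A 0) (coeff-Fsum (suc n) 0 A 1) ⟩
    + 1 * moment (suc n) 0ℤ A + + (suc n C 1) * moment n 0ℤ A * y
      ≡⟨ cong₂ (λ u c → u + + c * moment n 0ℤ A * y) (ℤₚ.*-identityˡ (moment (suc n) 0ℤ A)) (nC1≡n (suc n)) ⟩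
    moment (suc n) 0ℤ A + + suc n * moment n 0ℤ A * y ∎
    where
    open ≡-Reasoning
    1+n<2+m+n : ∀ m → suc n < 2 ℕ.+ m ℕ.+ n
    1+n<2+m+n m = s≤s (s≤s (ℕₚ.m≤n+m n m))

Antisymmetric : ℤ → (ℤ → ℤ) → Set
Antisymmetric c h = ∀ x → h x ≡ - h (c - x)

difference-antisymmetric : ∀ c (g h : ℤ → ℤ) → (∀ x → g x ≡ h x - h (c - x)) → Antisymmetric c g
difference-antisymmetric c g h g≡ x = begin
  g x
    ≡⟨ g≡ x ⟩
  h x - h (c - x)
    ≡⟨ cong (λ y → h y - h (c - x)) (reflect-reflect c x) ⟨
  h (c - (c - x)) - h (c - x)
    ≡⟨ swap (h (c - (c - x))) (h (c - x)) ⟩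
  - (h (c - x) - h (c - (c - x)))
    ≡⟨ cong -_ (g≡ (c - x)) ⟨
  - g (c - x) ∎
  where
  open ≡-Reasoning
  reflect-reflect : ∀ c x → c - (c - x) ≡ x
  reflect-reflect = solve-∀
  swap : ∀ a b → a - b ≡ - (b - a)
  swap = solve-∀

affine-antisymmetric-sum : ∀ {c c'} (h : ℤ → ℤ) k →
  (∀ y → h y ≡ h 0ℤ + k * y) → Antisymmetric c h → h 0ℤ + h c' ≡ k * (c' - c)
affine-antisymmetric-sum {c} {c'} h k affine antisym = begin
  h 0ℤ + h c'
    ≡⟨ cong (λ t → h 0ℤ + t) (affine c') ⟩
  h 0ℤ + (h 0ℤ + k * c')
    ≡⟨ regroup (h 0ℤ) k c c' ⟩
  (h 0ℤ + (h 0ℤ + k * (c - 0ℤ))) + k * (c' - c)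
    ≡⟨ cong (λ t → (h 0ℤ + t) + k * (c' - c)) (affine (c - 0ℤ)) ⟨
  (h 0ℤ + h (c - 0ℤ)) + k * (c' - c)
    ≡⟨ cong (λ t → (t + h (c - 0ℤ)) + k * (c' - c)) (antisym 0ℤ) ⟩
  (- h (c - 0ℤ) + h (c - 0ℤ)) + k * (c' - c)
    ≡⟨ cancel (h (c - 0ℤ)) (k * (c' - c)) ⟩
  k * (c' - c) ∎
  where
  open ≡-Reasoning
  regroup : ∀ d k c c' → d + (d + k * c') ≡ (d + (d + k * (c - 0ℤ))) + k * (c' - c)
  regroup = solve-∀
  cancel : ∀ a b → (- a + a) + b ≡ b
  cancel = solve-∀

moment-++ : ∀ s x as bs → moment s x (as ++ bs) ≡ moment s x as + moment s (+ length as + x) bs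
moment-++ s x []       bs =
  sym (trans (ℤₚ.+-identityˡ _) (cong (λ y → moment s y bs) (ℤₚ.+-identityˡ x)))
moment-++ s x (a ∷ as) bs = begin
  a * x ^ s + moment s (1ℤ + x) (as ++ bs)
    ≡⟨ cong (λ t → a * x ^ s + t) (moment-++ s (1ℤ + x) as bs) ⟩
  a * x ^ s + (moment s (1ℤ + x) as + moment s (+ length as + (1ℤ + x)) bs)
    ≡⟨ cong (λ y → a * x ^ s + (moment s (1ℤ + x) as + moment s y bs)) (shift (+ length as) x) ⟩
  a * x ^ s + (moment s (1ℤ + x) as + moment s (+ suc (length as) + x) bs)
    ≡⟨ ℤₚ.+-assoc (a * x ^ s) _ _ ⟨
  a * x ^ s + moment s (1ℤ + x) as + moment s (+ suc (length as) + x) bs ∎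
  where
  open ≡-Reasoning
  shift : ∀ l x → l + (1ℤ + x) ≡ 1ℤ + l + x
  shift = solve-∀

moment-reverse : ∀ s x as → moment s x (reverse as) ≡ -1ℤ ^ s * moment s (1ℤ - + length as - x) as
moment-reverse s x []       = sym (ℤₚ.*-zeroʳ (-1ℤ ^ s))
moment-reverse s x (a ∷ as) = begin
  moment s x (reverse (a ∷ as))
    ≡⟨ cong (moment s x) (Listₚ.unfold-reverse a as) ⟩
  moment s x (reverse as ++ a ∷ [])
    ≡⟨ moment-++ s x (reverse as) (a ∷ []) ⟩
  moment s x (reverse as) + moment s (+ length (reverse as) + x) (a ∷ [])
    ≡⟨ cong₂ (λ m l → m + moment s (+ l + x) (a ∷ [])) (moment-reverse s x as) (Listₚ.length-reverse as) ⟩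
  σ * M + (a * (L + x) ^ s + 0ℤ)
    ≡⟨ cong (λ t → σ * M + (a * t + 0ℤ)) (-1^s*[-z]^s≡z^s s (L + x)) ⟨
  σ * M + (a * (σ * (- (L + x)) ^ s) + 0ℤ)
    ≡⟨ regroup σ M a ((- (L + x)) ^ s) ⟩
  σ * (a * (- (L + x)) ^ s + M)
    ≡⟨ cong₂ (λ y z → σ * (a * y ^ s + moment s z as)) (reflect L x) (shift L x) ⟩
  σ * (a * (1ℤ - (1ℤ + L) - x) ^ s + moment s (1ℤ + (1ℤ - (1ℤ + L) - x)) as) ∎
  where
  open ≡-Reasoning
  σ : ℤ
  σ = -1ℤ ^ s
  L : ℤ
  L = + length as
  M : ℤ
  M = moment s (1ℤ - L - x) as
  regroup : ∀ σ M a w → σ * M + (a * (σ * w) + 0ℤ) ≡ σ * (a * w + M)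
  regroup = solve-∀
  reflect : ∀ L x → - (L + x) ≡ 1ℤ - (1ℤ + L) - x
  reflect = solve-∀
  shift : ∀ L x → 1ℤ - L - x ≡ 1ℤ + (1ℤ - (1ℤ + L) - x)
  shift = solve-∀

moment-map-neg : ∀ s x as → moment s x (map (-_) as) ≡ - moment s x as
moment-map-neg s x []       = refl
moment-map-neg s x (a ∷ as) =
  trans (cong (λ t → - a * x ^ s + t) (moment-map-neg s (1ℤ + x) as))
        (regroup a (x ^ s) (moment s (1ℤ + x) as))
  where
  regroup : ∀ a w m → - a * w + - m ≡ - (a * w + m)
  regroup = solve-∀

moment-palindrome : ∀ s x A →
  moment s x (A ++ reverse A) ≡ moment s x A + -1ℤ ^ s * moment s (1ℤ - + length (A ++ reverse A) - x) A
moment-palindrome s x A = begin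
  moment s x (A ++ reverse A)
    ≡⟨ moment-++ s x A (reverse A) ⟩
  moment s x A + moment s (L + x) (reverse A)
    ≡⟨ cong (λ t → moment s x A + t) (moment-reverse s (L + x) A) ⟩
  moment s x A + σ * moment s (1ℤ - L - (L + x)) A
    ≡⟨ cong (λ y → moment s x A + σ * moment s y A) (reflect L x) ⟩
  moment s x A + σ * moment s (1ℤ - (L + L) - x) A
    ≡⟨ cong (λ l → moment s x A + σ * moment s (1ℤ - + l - x) A) length-palindrome ⟨
  moment s x A + σ * moment s (1ℤ - + length (A ++ reverse A) - x) A ∎
  where
  open ≡-Reasoning
  σ : ℤ
  σ = -1ℤ ^ s
  L : ℤ
  L = + length A
  reflect : ∀ L x → 1ℤ - L - (L + x) ≡ 1ℤ - (L + L) - x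
  reflect = solve-∀
  length-palindrome : length (A ++ reverse A) ≡ length A ℕ.+ length A
  length-palindrome = trans (Listₚ.length-++ A) (cong (length A ℕ.+_) (Listₚ.length-reverse A))

snoc-1-reflection-cancels : ∀ s x w D → + length D + w ≡ - (+ length D + x) →
  moment s x (D ++ 1ℤ ∷ []) - -1ℤ ^ s * moment s w (D ++ 1ℤ ∷ []) ≡ moment s x D - -1ℤ ^ s * moment s w D
snoc-1-reflection-cancels s x w D L+w≡ = begin
  moment s x (D ++ 1ℤ ∷ []) - σ * moment s w (D ++ 1ℤ ∷ [])
    ≡⟨ cong₂ (λ u v → u - σ * v) (moment-++ s x D (1ℤ ∷ [])) (moment-++ s w D (1ℤ ∷ [])) ⟩
  (mD x + (1ℤ * (L + x) ^ s + 0ℤ)) - σ * (mD w + (1ℤ * (L + w) ^ s + 0ℤ))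
    ≡⟨ cong (λ y → (mD x + (1ℤ * (L + x) ^ s + 0ℤ)) - σ * (mD w + (1ℤ * y ^ s + 0ℤ))) L+w≡ ⟩
  (mD x + (1ℤ * (L + x) ^ s + 0ℤ)) - σ * (mD w + (1ℤ * (- (L + x)) ^ s + 0ℤ))
    ≡⟨ regroup σ (mD x) (mD w) ((L + x) ^ s) ((- (L + x)) ^ s) ⟩
  mD x - σ * mD w + ((L + x) ^ s - σ * (- (L + x)) ^ s)
    ≡⟨ cong (λ t → mD x - σ * mD w + ((L + x) ^ s - t)) (-1^s*[-z]^s≡z^s s (L + x)) ⟩
  mD x - σ * mD w + ((L + x) ^ s - (L + x) ^ s)
    ≡⟨ cancel (mD x - σ * mD w) ((L + x) ^ s) ⟩
  mD x - σ * mD w ∎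
  where
  open ≡-Reasoning
  σ : ℤ
  σ = -1ℤ ^ s
  L : ℤ
  L = + length D
  mD : ℤ → ℤ
  mD y = moment s y D
  regroup : ∀ σ a b u v → (a + (1ℤ * u + 0ℤ)) - σ * (b + (1ℤ * v + 0ℤ)) ≡ a - σ * b + (u - σ * v)
  regroup = solve-∀
  cancel : ∀ a b → a + (b - b) ≡ a
  cancel = solve-∀

moment-antipalindrome : ∀ s x D → let B = D ++ 0ℤ ∷ map (-_) (reverse D) in
  moment s x B ≡ moment s x (D ++ 1ℤ ∷ []) - -1ℤ ^ s * moment s (1ℤ - + length B - x) (D ++ 1ℤ ∷ [])
moment-antipalindrome s x D = begin
  moment s x (D ++ 0ℤ ∷ map (-_) (reverse D))
    ≡⟨ moment-++ s x D _ ⟩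
  mD x + (0ℤ * (L + x) ^ s + moment s (1ℤ + (L + x)) (map (-_) (reverse D)))
    ≡⟨ cong (λ t → mD x + (0ℤ * (L + x) ^ s + t))
            (trans (moment-map-neg s _ (reverse D)) (cong -_ (moment-reverse s (1ℤ + (L + x)) D))) ⟩
  mD x + (0ℤ * (L + x) ^ s + - (σ * mD (1ℤ - L - (1ℤ + (L + x)))))
    ≡⟨ cong (λ y → mD x + (0ℤ * (L + x) ^ s + - (σ * mD y))) w≡ ⟨
  mD x + (0ℤ * (L + x) ^ s + - (σ * mD w))
    ≡⟨ regroup (mD x) σ (mD w) ((L + x) ^ s) ⟩
  mD x - σ * mD w
    ≡⟨ snoc-1-reflection-cancels s x w D L+w≡ ⟨
  moment s x (D ++ 1ℤ ∷ []) - σ * moment s w (D ++ 1ℤ ∷ []) ∎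
  where
  open ≡-Reasoning
  σ : ℤ
  σ = -1ℤ ^ s
  L : ℤ
  L = + length D
  mD : ℤ → ℤ
  mD y = moment s y D
  w : ℤ
  w = 1ℤ - + length (D ++ 0ℤ ∷ map (-_) (reverse D)) - x
  length≡ : + length (D ++ 0ℤ ∷ map (-_) (reverse D)) ≡ L + (1ℤ + L)
  length≡ = cong +_ (trans (Listₚ.length-++ D)
                           (cong (λ l → length D ℕ.+ suc l)
                                 (trans (Listₚ.length-map (-_) (reverse D)) (Listₚ.length-reverse D))))
  w≡ : w ≡ 1ℤ - L - (1ℤ + (L + x))
  w≡ = trans (cong (λ l → 1ℤ - l - x) length≡) (reflect L x)
    where
    reflect : ∀ L x → 1ℤ - (L + (1ℤ + L)) - x ≡ 1ℤ - L - (1ℤ + (L + x))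
    reflect = solve-∀
  L+w≡ : L + w ≡ - (L + x)
  L+w≡ = trans (cong (λ l → L + (1ℤ - l - x)) length≡) (reflect L x)
    where
    reflect : ∀ L x → L + (1ℤ - (L + (1ℤ + L)) - x) ≡ - (L + x)
    reflect = solve-∀
  regroup : ∀ a σ b u → a + (0ℤ * u + - (σ * b)) ≡ a - σ * b
  regroup = solve-∀

lastOr-snoc : ∀ d xs x → lastOr d (xs ++ x ∷ []) ≡ x
lastOr-snoc d []       x = refl
lastOr-snoc d (y ∷ xs) x = lastOr-snoc y xs x

dropLast-snoc : ∀ xs x → dropLast (xs ++ x ∷ []) ≡ xs
dropLast-snoc []           x = refl
dropLast-snoc (y ∷ [])     x = refl
dropLast-snoc (y ∷ z ∷ xs) x = cong (y ∷_) (dropLast-snoc (z ∷ xs) x)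

step-palindrome : ∀ mid →
  step (1ℤ ∷ mid ++ -1ℤ ∷ []) ≡ (1ℤ ∷ mid ++ -1ℤ ∷ []) ++ reverse (1ℤ ∷ mid ++ -1ℤ ∷ [])
step-palindrome mid with 1ℤ ℤ.≟ - lastOr 1ℤ (mid ++ -1ℤ ∷ [])
... | yes _        = refl
... | no 1≢-last  = contradiction (cong -_ (sym (lastOr-snoc 1ℤ mid -1ℤ))) 1≢-last

step-antipalindrome : ∀ mid →
  step (1ℤ ∷ mid ++ 1ℤ ∷ []) ≡ (1ℤ ∷ mid) ++ 0ℤ ∷ map (-_) (reverse (1ℤ ∷ mid))
step-antipalindrome mid with 1ℤ ℤ.≟ - lastOr 1ℤ (mid ++ 1ℤ ∷ [])
... | yes 1≡-last = contradiction (trans 1≡-last (cong -_ (lastOr-snoc 1ℤ mid 1ℤ))) (λ ())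
... | no _ with 1ℤ ℤ.≟ lastOr 1ℤ (mid ++ 1ℤ ∷ [])
...   | yes _      = cong (λ D → D ++ 0ℤ ∷ map (-_) (reverse D)) (dropLast-snoc (1ℤ ∷ mid) 1ℤ)
...   | no 1≢last = contradiction (sym (lastOr-snoc 1ℤ mid 1ℤ)) 1≢last

record Unfolding (ℓ : ℤ) (A B : List ℤ) : Set where
  field
    body          : List ℤ
    shape         : B ≡ 1ℤ ∷ body ++ - ℓ ∷ []
    longer        : length A < length B
    moment-unfold : ∀ s x → moment s x B ≡ moment s x A - ℓ * -1ℤ ^ s * moment s (1ℤ - + length B - x) A

palindrome-unfolds : ∀ as → Unfolding -1ℤ (1ℤ ∷ as) ((1ℤ ∷ as) ++ reverse (1ℤ ∷ as))
palindrome-unfolds as = record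
  { body          = as ++ reverse as
  ; shape         = cong (1ℤ ∷_) (trans (cong (as ++_) (Listₚ.unfold-reverse 1ℤ as))
                                        (sym (Listₚ.++-assoc as (reverse as) (1ℤ ∷ []))))
  ; longer        = subst (length A <_) (sym (Listₚ.length-++ A))
                      (ℕₚ.m<m+n (length A) (subst (0 <_) (sym (Listₚ.length-reverse A)) (s≤s z≤n)))
  ; moment-unfold = λ s x → trans (moment-palindrome s x A) (regroup (moment s x A) (-1ℤ ^ s) _)
  }
  where
  A : List ℤ
  A = 1ℤ ∷ as
  regroup : ∀ a σ b → a + σ * b ≡ a - -1ℤ * σ * b
  regroup = solve-∀

antipalindrome-unfolds : ∀ mid →
  Unfolding 1ℤ ((1ℤ ∷ mid) ++ 1ℤ ∷ []) ((1ℤ ∷ mid) ++ 0ℤ ∷ map (-_) (reverse (1ℤ ∷ mid)))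
antipalindrome-unfolds mid = record
  { body          = mid ++ 0ℤ ∷ map (-_) (reverse mid)
  ; shape         = cong (1ℤ ∷_) (trans (cong (λ t → mid ++ 0ℤ ∷ t) negated-reverse)
                                        (sym (Listₚ.++-assoc mid (0ℤ ∷ map (-_) (reverse mid)) (-1ℤ ∷ []))))
  ; longer        = subst₂ _<_ (sym (Listₚ.length-++ D)) (sym (Listₚ.length-++ D))
                      (ℕₚ.+-monoʳ-< (length D) (s≤s (subst (0 <_) (sym length-negated-reverse) (s≤s z≤n))))
  ; moment-unfold = λ s x → trans (moment-antipalindrome s x D)
                                  (cong (λ t → moment s x A - t * moment s (R - x) A)
                                        (sym (ℤₚ.*-identityˡ (-1ℤ ^ s))))
  }
  where
  D : List ℤ
  D = 1ℤ ∷ mid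
  A : List ℤ
  A = D ++ 1ℤ ∷ []
  R : ℤ
  R = 1ℤ - + length (D ++ 0ℤ ∷ map (-_) (reverse D))
  negated-reverse : map (-_) (reverse D) ≡ map (-_) (reverse mid) ++ -1ℤ ∷ []
  negated-reverse = trans (cong (map (-_)) (Listₚ.unfold-reverse 1ℤ mid))
                          (Listₚ.map-++ (-_) (reverse mid) (1ℤ ∷ []))
  length-negated-reverse : length (map (-_) (reverse D)) ≡ length D
  length-negated-reverse = trans (Listₚ.length-map (-_) (reverse D)) (Listₚ.length-reverse D)

step-unfolds : ∀ ℓ mid → ℓ ≡ 1ℤ ⊎ ℓ ≡ -1ℤ →
  Unfolding ℓ (1ℤ ∷ mid ++ ℓ ∷ []) (step (1ℤ ∷ mid ++ ℓ ∷ []))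
step-unfolds _ mid (inj₁ refl) =
  subst (Unfolding 1ℤ _) (sym (step-antipalindrome mid)) (antipalindrome-unfolds mid)
step-unfolds _ mid (inj₂ refl) =
  subst (Unfolding -1ℤ _) (sym (step-palindrome mid)) (palindrome-unfolds (mid ++ -1ℤ ∷ []))

-- The invariant of the P-sequences

record Invariant (n : ℕ) (A : List ℤ) : Set where
  field
    body          : List ℤ
    shape         : A ≡ 1ℤ ∷ body ++ -1ℤ ^ n ∷ []
    vanish        : MomentsVanishBelow n A
    moment≢0      : moment n 0ℤ A ≢ 0ℤ
    antisymmetric : Antisymmetric (1ℤ - + length A) (λ x → moment (suc n) x A)

reflection-points-differ : ∀ {m n} → m < n → (1ℤ - + n - 0ℤ) - (1ℤ - + m) ≢ 0ℤ
reflection-points-differ {m} {n} m<n eq =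
  ℕₚ.<⇒≢ m<n (ℤₚ.+-injective (ℤₚ.i-j≡0⇒i≡j (+ m) (+ n) (trans (regroup (+ m) (+ n)) eq)))
  where
  regroup : ∀ m n → m - n ≡ (1ℤ - n - 0ℤ) - (1ℤ - m)
  regroup = solve-∀

module _ {n A B} (U : Unfolding (-1ℤ ^ n) A B) where
  open Unfolding U

  private
    R' : ℤ
    R' = 1ℤ - + length B

  unfold-vanish : MomentsVanishBelow n A → MomentsVanishBelow (suc n) B
  unfold-vanish vanish j j<1+n x with ℕₚ.m<1+n⇒m<n∨m≡n j<1+n
  ... | inj₁ j<n = begin
    moment j x B
      ≡⟨ moment-unfold j x ⟩
    moment j x A - -1ℤ ^ n * -1ℤ ^ j * moment j (R' - x) A
      ≡⟨ cong₂ (λ a b → a - -1ℤ ^ n * -1ℤ ^ j * b) (vanish j j<n x) (vanish j j<n (R' - x)) ⟩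
    0ℤ - -1ℤ ^ n * -1ℤ ^ j * 0ℤ
      ≡⟨ cancel (-1ℤ ^ n * -1ℤ ^ j) ⟩
    0ℤ ∎
    where
    open ≡-Reasoning
    cancel : ∀ a → 0ℤ - a * 0ℤ ≡ 0ℤ
    cancel = solve-∀
  ... | inj₂ refl = begin
    moment n x B
      ≡⟨ moment-unfold n x ⟩
    moment n x A - -1ℤ ^ n * -1ℤ ^ n * moment n (R' - x) A
      ≡⟨ cong₂ (λ a b → a - b * moment n (R' - x) A) (moment-constant {A = A} vanish x) (-1^n*-1^n≡1 n) ⟩
    moment n 0ℤ A - 1ℤ * moment n (R' - x) A
      ≡⟨ cong (λ b → moment n 0ℤ A - 1ℤ * b) (moment-constant {A = A} vanish (R' - x)) ⟩
    moment n 0ℤ A - 1ℤ * moment n 0ℤ A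
      ≡⟨ cancel (moment n 0ℤ A) ⟩
    0ℤ ∎
    where
    open ≡-Reasoning
    cancel : ∀ a → a - 1ℤ * a ≡ 0ℤ
    cancel = solve-∀

  unfold-moment≢0 : MomentsVanishBelow n A → moment n 0ℤ A ≢ 0ℤ →
    Antisymmetric (1ℤ - + length A) (λ x → moment (suc n) x A) → moment (suc n) 0ℤ B ≢ 0ℤ
  unfold-moment≢0 vanish c≢0 antisym =
    subst (_≢ 0ℤ) (sym value) (*-≢0 (*-≢0 {+ suc n} (λ ()) c≢0) (reflection-points-differ longer))
    where
    open ≡-Reasoning
    h : ℤ → ℤ
    h x = moment (suc n) x A
    k : ℤ
    k = + suc n * moment n 0ℤ A
    sign : -1ℤ ^ n * -1ℤ ^ suc n ≡ -1ℤ
    sign = trans (regroup (-1ℤ ^ n)) (cong (-1ℤ *_) (-1^n*-1^n≡1 n))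
      where
      regroup : ∀ a → a * (-1ℤ * a) ≡ -1ℤ * (a * a)
      regroup = solve-∀
    value : moment (suc n) 0ℤ B ≡ k * ((R' - 0ℤ) - (1ℤ - + length A))
    value = begin
      moment (suc n) 0ℤ B
        ≡⟨ moment-unfold (suc n) 0ℤ ⟩
      h 0ℤ - -1ℤ ^ n * -1ℤ ^ suc n * h (R' - 0ℤ)
        ≡⟨ cong (λ t → h 0ℤ - t * h (R' - 0ℤ)) sign ⟩
      h 0ℤ - -1ℤ * h (R' - 0ℤ)
        ≡⟨ regroup (h 0ℤ) (h (R' - 0ℤ)) ⟩
      h 0ℤ + h (R' - 0ℤ)
        ≡⟨ affine-antisymmetric-sum h k (moment-affine {A = A} vanish) antisym ⟩
      k * ((R' - 0ℤ) - (1ℤ - + length A)) ∎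
      where
      regroup : ∀ a b → a - -1ℤ * b ≡ a + b
      regroup = solve-∀

  unfold-antisymmetric : Antisymmetric R' (λ x → moment (suc (suc n)) x B)
  unfold-antisymmetric = difference-antisymmetric R' _ (λ x → moment (suc (suc n)) x A) λ x →
    trans (moment-unfold (suc (suc n)) x)
          (cong (λ t → moment (suc (suc n)) x A - t)
                (trans (cong (_* moment (suc (suc n)) (R' - x) A) sign) (ℤₚ.*-identityˡ _)))
    where
    sign : -1ℤ ^ n * -1ℤ ^ suc (suc n) ≡ 1ℤ
    sign = trans (regroup (-1ℤ ^ n)) (-1^n*-1^n≡1 n)
      where
      regroup : ∀ a → a * (-1ℤ * (-1ℤ * a)) ≡ a * a
      regroup = solve-∀

invariant-step : ∀ {n A} → Invariant n A → Invariant (suc n) (step A)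
invariant-step {n} record
  { body = body ; shape = refl ; vanish = vanish ; moment≢0 = c≢0 ; antisymmetric = antisym } =
  record
    { body          = U.body
    ; shape         = trans U.shape (cong (λ t → 1ℤ ∷ U.body ++ t ∷ []) (sym (ℤₚ.-1*i≡-i (-1ℤ ^ n))))
    ; vanish        = unfold-vanish U vanish
    ; moment≢0      = unfold-moment≢0 U vanish c≢0 antisym
    ; antisymmetric = unfold-antisymmetric U
    }
  where
  U : Unfolding (-1ℤ ^ n) (1ℤ ∷ body ++ -1ℤ ^ n ∷ []) (step (1ℤ ∷ body ++ -1ℤ ^ n ∷ []))
  U = step-unfolds (-1ℤ ^ n) body (-1^n≡1⊎-1^n≡-1 n)
  module U = Unfolding U

invariant-P₁ : Invariant 1 P₁
invariant-P₁ = record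
  { body          = []
  ; shape         = refl
  ; vanish        = λ { zero (s≤s z≤n) x → refl }
  ; moment≢0      = λ ()
  ; antisymmetric = antisymmetric
  }
  where
  antisymmetric : ∀ x → let y = 1ℤ - + 2 - x in
    1ℤ * (x * (x * 1ℤ)) + (-1ℤ * ((1ℤ + x) * ((1ℤ + x) * 1ℤ)) + 0ℤ)
      ≡ - (1ℤ * (y * (y * 1ℤ)) + (-1ℤ * ((1ℤ + y) * ((1ℤ + y) * 1ℤ)) + 0ℤ))
  antisymmetric = solve-∀

P-invariant : ∀ m → Invariant (suc m) (iter m P₁)
P-invariant zero    = invariant-P₁
P-invariant (suc m) = invariant-step (P-invariant m)

theorem1 : ∀ (n : ℕ) → 1 ≤ n → ∀ (s : ℕ) → n ≤ s → HasDegree (F n s) (s ∸ n)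
theorem1 (suc m) _ s n≤s = leading≢0 , higher≡0
  where
  open Invariant (P-invariant m)
  n : ℕ
  n = suc m
  leading≢0 : coeff (F n s) (s ∸ n) ≢ 0ℤ
  leading≢0 = subst (_≢ 0ℤ) (sym leading)
                    (*-≢0 (nCk≢0 (ℕₚ.m∸n≤m s n) ∘ ℤₚ.+-injective) moment≢0)
    where
    leading : coeff (F n s) (s ∸ n) ≡ + (s C (s ∸ n)) * moment n 0ℤ (P n)
    leading = trans (coeff-Fsum s 0 (P n) (s ∸ n))
                    (cong (λ k → + (s C (s ∸ n)) * moment k 0ℤ (P n)) (ℕₚ.m∸[m∸n]≡n n≤s))
  higher≡0 : ∀ j → s ∸ n < j → coeff (F n s) j ≡ 0ℤ
  higher≡0 j s∸n<j = coeff-Fsum-vanishes {A = P n} vanish s 0 j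
    (subst (_< j ℕ.+ n) (ℕₚ.m∸n+n≡m n≤s) (ℕₚ.+-monoˡ-< n s∸n<j))
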